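{- Let $n,d,p$ be integers with $0\le d<n$ and $1\le p\le n-d$, let $\tau\in\bar{\mathcal{S}}_p(n,d)$, and let $B=(b_1,\dots,b_d)$ be a $+$-subset of $\tau$. Let $i$ be the largest index in $[1,d]$ such that the $(\tau,B,i)$-series is left-aligned, or $i=0$ if no such index exists. Then $B$ is contained in the $+$-component $\mathcal{C}^\tau_i$.
   Context: $[a,b]=\{x\in\mathbb{Z}:a\le x\le b\}$, $[n]=[1,n]$. A $d$-subset of $[n]$ is written as its increasing tuple $B=(b_1,\dots,b_d)$. For a function $f$ on $d$-subsets of $[n]$, a $d$-subset $B$ and $j\in[d]$, let $B_j=B\setminus\{b_j\}$ and $[n]\setminus B_j=\{x_1<\dots<x_{n-d+1}\}$; the $(f,B,j)$-series is $(f(B_j\cup\{x_1\}),\dots,f(B_j\cup\{x_{n-d+1}\}))$, and for $f$ the identity it is called the $(B,j)$-series. For $0\le d<n$, a $d$-co-signotope on $n$ elements is a map $\tau:\binom{[n]}{d}\to\{+,-\}$ such that every $(\tau,B,j)$-series has at most one sign change. A $+$-subset of $\tau$ is a $d$-subset $R$ with $\tau(R)=+$. $\bar{\mathcal{S}}_p(n,d)$ is the set of $d$-co-signotopes on $n$ elements with exactly $p$ $+$-subsets. A $(\tau,B,j)$-series is left-aligned if its first entry is $+$ and its last entry is $-$. The graph $G_{n,d}$ has the $d$-subsets of $[n]$ as vertices, two being adjacent if they are consecutive entries of some $(B,j)$-series. A $+$-component of $\tau$ is a connected component of the subgraph of $G_{n,d}$ induced by the $+$-subsets of $\tau$. For $i\in[0,d]$,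 $S_{n,d,i}=\{1,\dots,i\}\cup\{n-d+i+1,\dots,n\}$, and $\mathcal{C}^\tau_i$ denotes the $+$-component of $\tau$ containing $S_{n,d,i}$ (empty if $\tau(S_{n,d,i})=-$). -}

module Defs where

open import Data.Nat using (ℕ; zero; suc; _+_; _∸_; _≤_; _<_; _<ᵇ_)
open import Data.Nat.Properties using (_≟_)
open import Data.Bool using (if_then_else_)
open import Data.List using (List; []; _∷_; _++_; map; upTo; filter; length; head; last)
open import Data.List.Relation.Unary.All using (All)
open import Data.List.Relation.Unary.Linked using (Linked)
open import Data.List.Relation.Unary.Unique.Propositional using (Unique)
open import Data.List.Membership.Propositional using (_∈_)
open import Data.List.Membership.DecPropositional _≟_ using (_∈?_)
open import Data.Maybe using (Maybe; just)
open import Data.Product using (Σ; ∃; _×_; _,_)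
open import Data.Sum using (_⊎_)
open import Relation.Nullary using (¬_; ¬?)
open import Relation.Binary.PropositionalEquality using (_≡_)

data Sign : Set where
  ⊕ ⊖ : Sign

[_,_] : ℕ → ℕ → List ℕ
[ a , b ] = map (λ k → a + k) (upTo (suc b ∸ a))

IsSubset : ℕ → ℕ → List ℕ → Set
IsSubset n d B = Linked _<_ B × length B ≡ d × All (λ x → 1 ≤ x × x ≤ n) B

-- remove the j-th entry (1-based) of a tuple: B_j = B \ {b_j}
removeAt : ℕ → List ℕ → List ℕ
removeAt _ [] = []
removeAt zero (x ∷ xs) = x ∷ xs          -- index 0 is never used
removeAt (suc zero) (x ∷ xs) = xs
removeAt (suc (suc j)) (x ∷ xs) = x ∷ removeAt (suc j) xs

insert : ℕ → List ℕ → List ℕ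
insert x [] = x ∷ []
insert x (y ∷ ys) = if x <ᵇ y then x ∷ y ∷ ys else y ∷ insert x ys

complement : ℕ → List ℕ → List ℕ
complement n A = filter (λ x → ¬? (x ∈? A)) [ 1 , n ]

series : {A : Set} → (List ℕ → A) → ℕ → List ℕ → ℕ → List A
series f n B j = map (λ x → f (insert x (removeAt j B))) (complement n (removeAt j B))

differ : Sign → Sign → ℕ
differ ⊕ ⊕ = 0
differ ⊖ ⊖ = 0
differ ⊕ ⊖ = 1
differ ⊖ ⊕ = 1

signChanges : List Sign → ℕ
signChanges [] = 0
signChanges (x ∷ []) = 0
signChanges (x ∷ y ∷ r) = differ x y + signChanges (y ∷ r)

-- τ (given on all finite lists; only its values on d-subsets of [n] matter)
-- is a d-co-signotope on n elements
IsCoSignotope : ℕ → ℕ → (List ℕ → Sign) → Set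
IsCoSignotope n d τ =
  ∀ B → IsSubset n d B → ∀ j → 1 ≤ j → j ≤ d → signChanges (series τ n B j) ≤ 1

HasPlusCount : ℕ → ℕ → ℕ → (List ℕ → Sign) → Set
HasPlusCount n d p τ =
  Σ (List (List ℕ)) λ L → Unique L × length L ≡ p ×
    (∀ R → (R ∈ L → IsSubset n d R × τ R ≡ ⊕) × (IsSubset n d R × τ R ≡ ⊕ → R ∈ L))

InSbar : ℕ → ℕ → ℕ → (List ℕ → Sign) → Set
InSbar p n d τ = IsCoSignotope n d τ × HasPlusCount n d p τ

LeftAligned : ℕ → (List ℕ → Sign) → List ℕ → ℕ → Set
LeftAligned n τ B j = head (series τ n B j) ≡ just ⊕ × last (series τ n B j) ≡ just ⊖

Consecutive : {X : Set} → X → X → List X → Set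
Consecutive {X} a a' L = Σ (List X) λ xs → Σ (List X) λ ys → L ≡ xs ++ (a ∷ a' ∷ ys)

Adjacent : ℕ → ℕ → List ℕ → List ℕ → Set
Adjacent n d A A' =
  Σ (List ℕ) λ B → Σ ℕ λ j → IsSubset n d B × 1 ≤ j × j ≤ d ×
    (Consecutive A A' (series (λ X → X) n B j) ⊎ Consecutive A' A (series (λ X → X) n B j))

-- A' is reachable from A by a path in G_{n,d} through +-subsets of τ
-- (i.e. A' lies in the +-component of τ containing A)
data PlusConnected (n d : ℕ) (τ : List ℕ → Sign) (A : List ℕ) : List ℕ → Set where
  here : IsSubset n d A → τ A ≡ ⊕ → PlusConnected n d τ A A
  step : ∀ {A' A''} → PlusConnected n d τ A A' → Adjacent n d A' A'' → τ A'' ≡ ⊕ →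
         PlusConnected n d τ A A''

S : ℕ → ℕ → ℕ → List ℕ
S n d i = [ 1 , i ] ++ [ suc (n ∸ d + i) , n ]

IsLargestLeftAligned : ℕ → ℕ → (List ℕ → Sign) → List ℕ → ℕ → Set
IsLargestLeftAligned n d τ B i =
  ((i ≡ 0) × (∀ j → 1 ≤ j → j ≤ d → ¬ LeftAligned n τ B j))
  ⊎ (1 ≤ i × i ≤ d × LeftAligned n τ B i × (∀ j → i < j → j ≤ d → ¬ LeftAligned n τ B j))

-- Every (τ,B,j)-series has at most one sign change, so on a +-subset its + entries form an initial
-- run if the series is left-aligned and a final run otherwise. An initial run of one series cannot
-- overlap a final run of another whose (d-1)-set agrees with the first one above the overlap:
-- gluing the two runs yields n - d + 1 distinct +-subsets, more than p ≤ n - d. Hence the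
-- left-aligned series of B are exactly those at positions 1..i, and this pattern survives moving
-- one element of a +-subset by ±1 to another +-subset. Moving an element to the right keeps a set +
-- when its series is not left-aligned, moving it to the left when it is; so B is joined to
-- S_{n,d,i} through +-subsets by pushing b_d, ..., b_{i+1} up to n, ..., n-d+i+1 and then pulling
-- b_1, ..., b_i down to 1, ..., i.
{-# OPTIONS --safe #-}
module Submission where

open import Defs
open import Data.Bool using (true; false)
open import Data.Empty using (⊥; ⊥-elim)
open import Data.List
  using (List; []; _∷_; _++_; map; upTo; length; head; last; reverse; take; drop)
open import Data.List.Properties
  using ( length-++; length-map; length-upTo; map-++; ++-assoc; ++-identityʳ; unfold-reverse
        ; reverse-involutive; length-take; take++drop≡id; last-map)
open import Data.List.Membership.Propositional using (_∈_; _∉_)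
open import Data.List.Membership.Propositional.Properties
  using (∈-++⁺ˡ; ∈-++⁺ʳ; ∈-++⁻; ∈-map⁻; ∈-map⁺; ∈-filter⁺; ∈-filter⁻; ∈-∃++; ∈-upTo⁺; ∈-upTo⁻)
open import Data.List.Relation.Binary.Subset.Propositional using (_⊆_)
open import Data.List.Relation.Unary.All as All using (All; []; _∷_)
import Data.List.Relation.Unary.All.Properties as All
open import Data.List.Relation.Unary.AllPairs as AllPairs using (AllPairs; []; _∷_)
import Data.List.Relation.Unary.AllPairs.Properties as AllPairs
open import Data.List.Relation.Unary.Any using (here; there)
open import Data.List.Relation.Unary.Linked.Properties using (AllPairs⇒Linked; Linked⇒AllPairs)
open import Data.List.Relation.Unary.Unique.Propositional using (Unique)
open import Data.Maybe as Maybe using (just)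
import Data.Maybe.Properties as Maybeₚ
open import Data.Nat
  using ( ℕ; zero; suc; _+_; _∸_; _≤_; _<_; _≮_; _<ᵇ_; _≤′_; ≤′-refl; ≤′-step; z≤n; s≤s; s≤s⁻¹
        ; _≤?_; _<?_)
open import Data.Nat.Properties
open import Data.List.Membership.DecPropositional _≟_ using (_∈?_)
open import Data.Product using (Σ; ∃; ∃₂; _×_; _,_; proj₁; proj₂)
open import Data.Sum as Sum using (_⊎_; inj₁; inj₂; [_,_]′)
open import Function using (id; _∘_)
open import Function.Bundles using (_⇔_; mk⇔; module Equivalence)
open import Function.Construct.Composition using (_⇔-∘_)
open import Relation.Binary.Definitions using (DecidableEquality; tri<; tri≈; tri>)
open import Relation.Binary.PropositionalEquality hiding ([_])
open import Relation.Nullary using (¬_; ¬?; yes; no; contradiction)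
open import Relation.Nullary.Decidable using (Dec; _×-dec_)

-- Sorted lists of naturals

Sorted : List ℕ → Set
Sorted = AllPairs _<_

∈-tail : ∀ {x y : ℕ} {ys} → x ∈ y ∷ ys → y < x → x ∈ ys
∈-tail (here refl) x<x = contradiction x<x (<-irrefl refl)
∈-tail (there x∈ys) _ = x∈ys

Sorted-head-≡ : ∀ {x y xs ys} → Sorted (x ∷ xs) → Sorted (y ∷ ys) →
  x ∈ y ∷ ys → y ∈ x ∷ xs → x ≡ y
Sorted-head-≡ _ _ (here x≡y) _ = x≡y
Sorted-head-≡ _ _ (there _) (here y≡x) = sym y≡x
Sorted-head-≡ (x< ∷ _) (y< ∷ _) (there x∈ys) (there y∈xs) =
  contradiction (All.lookup y< x∈ys) (<⇒≯ (All.lookup x< y∈xs))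

Sorted-≡ : ∀ {xs ys} → Sorted xs → Sorted ys → xs ⊆ ys → ys ⊆ xs → xs ≡ ys
Sorted-≡ {[]} {[]} _ _ _ _ = refl
Sorted-≡ {[]} {_ ∷ _} _ _ _ ys⊆xs with () ← ys⊆xs (here refl)
Sorted-≡ {_ ∷ _} {[]} _ _ xs⊆ys _ with () ← xs⊆ys (here refl)
Sorted-≡ {x ∷ xs} {y ∷ ys} sx@(x< ∷ sxs) sy@(y< ∷ sys) xs⊆ys ys⊆xs
  with refl ← Sorted-head-≡ sx sy (xs⊆ys (here refl)) (ys⊆xs (here refl)) =
  cong (x ∷_) (Sorted-≡ sxs sys (λ z∈ → ∈-tail (xs⊆ys (there z∈)) (All.lookup x< z∈))
                                (λ z∈ → ∈-tail (ys⊆xs (there z∈)) (All.lookup y< z∈)))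

Sorted-++⁻ : ∀ xs {ys} → Sorted (xs ++ ys) →
  Sorted xs × Sorted ys × All (λ x → All (x <_) ys) xs
Sorted-++⁻ [] s = [] , s , []
Sorted-++⁻ (x ∷ xs) (x< ∷ s) with Sorted-++⁻ xs s
... | sxs , sys , xs<ys = All.++⁻ˡ xs x< ∷ sxs , sys , All.++⁻ʳ xs x< ∷ xs<ys

∈-hole : ∀ {A : Set} xs {a : A} {ys} → a ∈ xs ++ a ∷ ys
∈-hole xs = ∈-++⁺ʳ xs (here refl)

∈-hole⁺ : ∀ {A : Set} xs {a z : A} {ys} → z ∈ xs ++ ys → z ∈ xs ++ a ∷ ys
∈-hole⁺ xs z∈ with ∈-++⁻ xs z∈
... | inj₁ z∈xs = ∈-++⁺ˡ z∈xs
... | inj₂ z∈ys = ∈-++⁺ʳ xs (there z∈ys)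

∈-hole⁻ : ∀ {A : Set} xs {a z : A} {ys} → z ∈ xs ++ a ∷ ys → z ≡ a ⊎ z ∈ xs ++ ys
∈-hole⁻ xs z∈ with ∈-++⁻ xs z∈
... | inj₁ z∈xs = inj₂ (∈-++⁺ˡ z∈xs)
... | inj₂ (here z≡a) = inj₁ z≡a
... | inj₂ (there z∈ys) = inj₂ (∈-++⁺ʳ xs z∈ys)

length-hole : ∀ {A : Set} xs {a : A} {ys} → length (xs ++ a ∷ ys) ≡ suc (length (xs ++ ys))
length-hole [] = refl
length-hole (_ ∷ xs) = cong suc (length-hole xs)

hole-position≤ : ∀ {A : Set} xs {a : A} {ys} → suc (length xs) ≤ length (xs ++ a ∷ ys)
hole-position≤ [] = s≤s z≤n
hole-position≤ (_ ∷ xs) = s≤s (hole-position≤ xs)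

hole-∉ : ∀ xs {a ys} → Sorted (xs ++ a ∷ ys) → a ∉ xs ++ ys
hole-∉ xs s a∈ with Sorted-++⁻ xs s | ∈-++⁻ xs a∈
... | _ , _ , xs< | inj₁ a∈xs = <-irrefl refl (All.head (All.lookup xs< a∈xs))
... | _ , a< ∷ _ , _ | inj₂ a∈ys = <-irrefl refl (All.lookup a< a∈ys)

hole-∉-swap : ∀ xs {a a' ys} → Sorted (xs ++ a ∷ ys) → a ≢ a' → a ∉ xs ++ a' ∷ ys
hole-∉-swap xs s a≢a' a∈ with ∈-hole⁻ xs a∈
... | inj₁ a≡a' = a≢a' a≡a'
... | inj₂ a∈xs++ys = hole-∉ xs s a∈xs++ys

hole-above : ∀ xs {a ys} → Sorted (xs ++ a ∷ ys) → All (_< a) xs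
hole-above xs s = All.map All.head (proj₂ (proj₂ (Sorted-++⁻ xs s)))

hole-below : ∀ xs {a ys} → Sorted (xs ++ a ∷ ys) → All (a <_) ys
hole-below xs s = AllPairs.head (proj₁ (proj₂ (Sorted-++⁻ xs s)))

Sorted-hole-removed : ∀ xs {a ys} → Sorted (xs ++ a ∷ ys) → Sorted (xs ++ ys)
Sorted-hole-removed xs s with Sorted-++⁻ xs s
... | sxs , _ ∷ sys , xs< = AllPairs.++⁺ sxs sys (All.map All.tail xs<)

Sorted-hole-replaced : ∀ xs {a a' ys} → Sorted (xs ++ a ∷ ys) →
  All (_< a') xs → All (a' <_) ys → Sorted (xs ++ a' ∷ ys)
Sorted-hole-replaced xs s xs<a' a'<ys with Sorted-++⁻ xs s
... | sxs , _ ∷ sys , xs< =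
  AllPairs.++⁺ sxs (a'<ys ∷ sys) (All.zipWith (λ (x<a' , x<) → x<a' ∷ All.tail x<) (xs<a' , xs<))

++-reverse-∷ : ∀ {A : Set} xs (q : A) rs ys →
  xs ++ reverse (q ∷ rs) ++ ys ≡ (xs ++ reverse rs) ++ q ∷ ys
++-reverse-∷ xs q rs ys = begin
  xs ++ reverse (q ∷ rs) ++ ys        ≡⟨ cong (λ zs → xs ++ zs ++ ys) (unfold-reverse q rs) ⟩
  xs ++ (reverse rs ++ q ∷ []) ++ ys  ≡⟨ cong (xs ++_) (++-assoc (reverse rs) (q ∷ []) ys) ⟩
  xs ++ reverse rs ++ q ∷ ys          ≡⟨ ++-assoc xs (reverse rs) (q ∷ ys) ⟨
  (xs ++ reverse rs) ++ q ∷ ys        ∎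
  where open ≡-Reasoning

Unique-⊆⇒length≤ : ∀ {A : Set} {xs ys : List A} → Unique xs → xs ⊆ ys → length xs ≤ length ys
Unique-⊆⇒length≤ [] _ = z≤n
Unique-⊆⇒length≤ {xs = x ∷ xs} (x∉xs ∷ u) x∷xs⊆ys with ∈-∃++ (x∷xs⊆ys (here refl))
... | us , vs , refl = begin
  suc (length xs)         ≤⟨ s≤s (Unique-⊆⇒length≤ u xs⊆us++vs) ⟩
  suc (length (us ++ vs)) ≡⟨ length-hole us ⟨
  length (us ++ x ∷ vs)   ∎
  where
  open ≤-Reasoning
  xs⊆us++vs : xs ⊆ us ++ vs
  xs⊆us++vs z∈ with ∈-hole⁻ us (x∷xs⊆ys (there z∈))
  ... | inj₁ refl = contradiction refl (All.lookup x∉xs z∈)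
  ... | inj₂ z∈us++vs = z∈us++vs

Unique-map-sorted : ∀ {A : Set} (f : ℕ → A) {xs} → Sorted xs →
  (∀ {y y'} → y ∈ xs → y' ∈ xs → y < y' → f y ≢ f y') → Unique (map f xs)
Unique-map-sorted f [] _ = []
Unique-map-sorted f (x< ∷ s) f-injective =
  All.map⁺ (All.tabulate (λ y∈ → f-injective (here refl) (there y∈) (All.lookup x< y∈)))
  ∷ Unique-map-sorted f s (λ y∈ y'∈ → f-injective (there y∈) (there y'∈))

-- Insertion into a sorted list

insert-< : ∀ {x y} ys → x < y → insert x (y ∷ ys) ≡ x ∷ y ∷ ys
insert-< {x} {y} ys x<y with x <ᵇ y | <⇒<ᵇ x<y
... | true | _ = refl

insert-≮ : ∀ {x y} ys → x ≮ y → insert x (y ∷ ys) ≡ y ∷ insert x ys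
insert-≮ {x} {y} ys x≮y with x <ᵇ y | <ᵇ⇒< x y
... | true | x<y = contradiction (x<y _) x≮y
... | false | _ = refl

insert-split : ∀ x D → ∃₂ λ us vs → D ≡ us ++ vs × insert x D ≡ us ++ x ∷ vs
insert-split x [] = [] , [] , refl , refl
insert-split x (y ∷ ys) with x <? y
... | yes x<y = [] , y ∷ ys , refl , insert-< ys x<y
... | no x≮y with insert-split x ys
...   | us , vs , refl , eq = y ∷ us , vs , refl , trans (insert-≮ ys x≮y) (cong (y ∷_) eq)

∈-insert⁺ˡ : ∀ x D → x ∈ insert x D
∈-insert⁺ˡ x D with insert-split x D
... | us , _ , refl , eq = subst (x ∈_) (sym eq) (∈-hole us)

∈-insert⁺ʳ : ∀ {z} x {D} → z ∈ D → z ∈ insert x D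
∈-insert⁺ʳ x {D} z∈ with insert-split x D
... | us , _ , refl , eq = subst (_ ∈_) (sym eq) (∈-hole⁺ us z∈)

∈-insert⁻ : ∀ {z} x D → z ∈ insert x D → z ≡ x ⊎ z ∈ D
∈-insert⁻ x D z∈ with insert-split x D
... | us , _ , refl , eq = ∈-hole⁻ us (subst (_ ∈_) eq z∈)

∈-insert-≢ : ∀ {z x D} → z ∈ insert x D → z ≢ x → z ∈ D
∈-insert-≢ {D = D} z∈ z≢x with ∈-insert⁻ _ D z∈
... | inj₁ z≡x = contradiction z≡x z≢x
... | inj₂ z∈D = z∈D

length-insert : ∀ x D → length (insert x D) ≡ suc (length D)
length-insert x D with insert-split x D
... | us , _ , refl , eq = trans (cong length eq) (length-hole us)

Sorted-insert : ∀ {x} D → Sorted D → x ∉ D → Sorted (insert x D)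
Sorted-insert [] _ _ = [] ∷ []
Sorted-insert {x} (y ∷ ys) (y< ∷ s) x∉ with x <? y
... | yes x<y rewrite insert-< ys x<y = (x<y ∷ All.map (<-trans x<y) y<) ∷ y< ∷ s
... | no x≮y rewrite insert-≮ ys x≮y = All.tabulate y<insert ∷ Sorted-insert ys s (x∉ ∘ there)
  where
  y<insert : ∀ {z} → z ∈ insert x ys → y < z
  y<insert z∈ with ∈-insert⁻ x ys z∈
  ... | inj₁ refl = ≤∧≢⇒< (≮⇒≥ x≮y) (λ y≡x → x∉ (here (sym y≡x)))
  ... | inj₂ z∈ys = All.lookup y< z∈ys

insert-hole : ∀ xs {a ys} → Sorted (xs ++ a ∷ ys) → insert a (xs ++ ys) ≡ xs ++ a ∷ ys
insert-hole [] {ys = []} _ = refl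
insert-hole [] {ys = y ∷ ys} ((a<y ∷ _) ∷ _) = insert-< ys a<y
insert-hole (x ∷ xs) (x< ∷ s) =
  trans (insert-≮ (xs ++ _) (<⇒≯ (All.lookup x< (∈-hole xs)))) (cong (x ∷_) (insert-hole xs s))

insert-swap : ∀ xs {a a' ys} → Sorted (xs ++ a ∷ ys) → Sorted (xs ++ a' ∷ ys) → a ≢ a' →
  insert a' (xs ++ a ∷ ys) ≡ insert a (xs ++ a' ∷ ys)
insert-swap xs s s' a≢a' =
  Sorted-≡ (Sorted-insert _ s (hole-∉-swap xs s' (a≢a' ∘ sym)))
           (Sorted-insert _ s' (hole-∉-swap xs s a≢a'))
           swap-⊆ swap-⊆
  where
  swap-⊆ : ∀ {a a' ys} → insert a' (xs ++ a ∷ ys) ⊆ insert a (xs ++ a' ∷ ys)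
  swap-⊆ {a} {a'} z∈ with ∈-insert⁻ a' _ z∈
  ... | inj₁ refl = ∈-insert⁺ʳ a (∈-hole xs)
  ... | inj₂ z∈D with ∈-hole⁻ xs z∈D
  ...   | inj₁ refl = ∈-insert⁺ˡ a (xs ++ a' ∷ _)
  ...   | inj₂ z∈xs++ys = ∈-insert⁺ʳ a (∈-hole⁺ xs z∈xs++ys)

-- Intervals and complements

m<n∸o⇒o+m<n : ∀ o {m n} → m < n ∸ o → o + m < n
m<n∸o⇒o+m<n zero m<n = m<n
m<n∸o⇒o+m<n (suc o) {n = suc n} m<n∸o = s≤s (m<n∸o⇒o+m<n o m<n∸o)

n∸[i+[n∸m]]+i≡m : ∀ {m n} i → m ≤ n → i + (n ∸ m) ≤ n → n ∸ (i + (n ∸ m)) + i ≡ m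
n∸[i+[n∸m]]+i≡m {m} {n} i m≤n i+[n∸m]≤n = begin
  n ∸ (i + (n ∸ m)) + i  ≡⟨ cong (λ x → n ∸ x + i) (+-comm i (n ∸ m)) ⟩
  n ∸ ((n ∸ m) + i) + i  ≡⟨ cong (_+ i) (∸-+-assoc n (n ∸ m) i) ⟨
  n ∸ (n ∸ m) ∸ i + i    ≡⟨ cong (λ x → x ∸ i + i) (m∸[m∸n]≡n m≤n) ⟩
  m ∸ i + i              ≡⟨ m∸n+n≡m (subst (i ≤_) (m∸[m∸n]≡n m≤n) (m+n≤o⇒m≤o∸n i i+[n∸m]≤n)) ⟩
  m                      ∎
  where open ≡-Reasoning

∈-interval⁻ : ∀ {a b z} → z ∈ [ a , b ] → a ≤ z × z ≤ b
∈-interval⁻ {a} z∈ with ∈-map⁻ (a +_) z∈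
... | k , k∈ , refl = m≤m+n a k , s≤s⁻¹ (m<n∸o⇒o+m<n a (∈-upTo⁻ k∈))

∈-interval⁺ : ∀ {a b z} → a ≤ z → z ≤ b → z ∈ [ a , b ]
∈-interval⁺ {a} a≤z z≤b =
  subst (_∈ _) (m+[n∸m]≡n a≤z) (∈-map⁺ (a +_) (∈-upTo⁺ (∸-monoˡ-< (s≤s z≤b) a≤z)))

Sorted-interval : ∀ a b → Sorted [ a , b ]
Sorted-interval a b =
  AllPairs.map⁺ (AllPairs.applyUpTo⁺₁ id (suc b ∸ a) (λ i<j _ → +-monoʳ-< a i<j))

length-interval : ∀ a b → length [ a , b ] ≡ suc b ∸ a
length-interval a b = trans (length-map (a +_) (upTo (suc b ∸ a))) (length-upTo (suc b ∸ a))

interval-empty : ∀ n → [ suc n , n ] ≡ []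
interval-empty n = cong (map (suc n +_) ∘ upTo) (n∸n≡0 n)

interval-unfoldˡ : ∀ {m n} → m ≤ n → [ m , n ] ≡ m ∷ [ suc m , n ]
interval-unfoldˡ {m} {n} m≤n =
  Sorted-≡ (Sorted-interval m n) (All.tabulate (proj₁ ∘ ∈-interval⁻) ∷ Sorted-interval (suc m) n)
           into onto
  where
  into : [ m , n ] ⊆ m ∷ [ suc m , n ]
  into {z} z∈ with ∈-interval⁻ z∈ | m ≟ z
  ... | _ | yes refl = here refl
  ... | m≤z , z≤m | no m≢z = there (∈-interval⁺ (≤∧≢⇒< m≤z m≢z) z≤m)
  onto : m ∷ [ suc m , n ] ⊆ [ m , n ]
  onto (here refl) = ∈-interval⁺ ≤-refl m≤n
  onto (there z∈) with ∈-interval⁻ z∈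
  ... | m<z , z≤m = ∈-interval⁺ (<⇒≤ m<z) z≤m

interval-snoc : ∀ a ys → [ 1 , a ] ++ suc a ∷ ys ≡ [ 1 , suc a ] ++ ys
interval-snoc a ys = begin
  [ 1 , a ] ++ suc a ∷ ys          ≡⟨ ++-assoc [ 1 , a ] (suc a ∷ []) ys ⟨
  ([ 1 , a ] ++ suc a ∷ []) ++ ys  ≡⟨ cong (_++ ys) snoc ⟩
  [ 1 , suc a ] ++ ys              ∎
  where
  open ≡-Reasoning
  below : All (λ x → All (x <_) (suc a ∷ [])) [ 1 , a ]
  below = All.tabulate (λ x∈ → s≤s (proj₂ (∈-interval⁻ x∈)) ∷ [])
  into : [ 1 , a ] ++ suc a ∷ [] ⊆ [ 1 , suc a ]
  into z∈ with ∈-hole⁻ [ 1 , a ] z∈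
  ... | inj₁ refl = ∈-interval⁺ {1} {suc a} (s≤s z≤n) ≤-refl
  ... | inj₂ z∈′ with ∈-interval⁻ {1} {a} (subst (_ ∈_) (++-identityʳ _) z∈′)
  ...   | 1≤z , z≤a = ∈-interval⁺ {1} {suc a} 1≤z (m≤n⇒m≤1+n z≤a)
  onto : [ 1 , suc a ] ⊆ [ 1 , a ] ++ suc a ∷ []
  onto {z} z∈ with ∈-interval⁻ {1} {suc a} z∈ | z ≟ suc a
  ... | _ | yes refl = ∈-hole [ 1 , a ]
  ... | 1≤z , z≤1+a | no z≢1+a = ∈-++⁺ˡ (∈-interval⁺ {1} {a} 1≤z (s≤s⁻¹ (≤∧≢⇒< z≤1+a z≢1+a)))
  snoc : [ 1 , a ] ++ suc a ∷ [] ≡ [ 1 , suc a ]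
  snoc = Sorted-≡ (AllPairs.++⁺ (Sorted-interval 1 a) ([] ∷ []) below) (Sorted-interval 1 (suc a))
                  into onto

module _ (n : ℕ) (D : List ℕ) where

  private
    ∉D? : ∀ x → Dec (x ∉ D)
    ∉D? x = ¬? (x ∈? D)

  ∈-complement⁺ : ∀ {z} → z ∈ [ 1 , n ] → z ∉ D → z ∈ complement n D
  ∈-complement⁺ = ∈-filter⁺ ∉D?

  ∈-complement⁻ : ∀ {z} → z ∈ complement n D → z ∈ [ 1 , n ] × z ∉ D
  ∈-complement⁻ = ∈-filter⁻ ∉D?

  Sorted-complement : Sorted (complement n D)
  Sorted-complement = AllPairs.filter⁺ ∉D? (Sorted-interval 1 n)

  length-complement : n ≤ length D + length (complement n D)
  length-complement = begin
    n                                   ≡⟨ length-interval 1 n ⟨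
    length [ 1 , n ]                    ≤⟨ Unique-⊆⇒length≤ unique split ⟩
    length (D ++ complement n D)        ≡⟨ length-++ D ⟩
    length D + length (complement n D)  ∎
    where
    open ≤-Reasoning
    unique : Unique [ 1 , n ]
    unique = AllPairs.map <⇒≢ (Sorted-interval 1 n)
    split : [ 1 , n ] ⊆ D ++ complement n D
    split {z} z∈ with z ∈? D
    ... | yes z∈D = ∈-++⁺ˡ z∈D
    ... | no z∉D = ∈-++⁺ʳ D (∈-complement⁺ z∈ z∉D)

-- k-subsets of [n]

record Sub (n k : ℕ) (C : List ℕ) : Set where
  field
    sorted  : Sorted C
    length≡ : length C ≡ k
    bounded : C ⊆ [ 1 , n ]

open Sub

Sub⇒IsSubset : ∀ {n k C} → Sub n k C → IsSubset n k C
Sub⇒IsSubset s = AllPairs⇒Linked (sorted s) , length≡ s , All.tabulate (∈-interval⁻ ∘ bounded s)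

IsSubset⇒Sub : ∀ {n k C} → IsSubset n k C → Sub n k C
IsSubset⇒Sub (linked , |C|≡k , C-bounded) = record
  { sorted = Linked⇒AllPairs <-trans linked
  ; length≡ = |C|≡k
  ; bounded = λ z∈ → let (1≤z , z≤max) = All.lookup C-bounded z∈ in ∈-interval⁺ 1≤z z≤max
  }

Sub-insert : ∀ {n k D b} → Sub n k D → b ∈ complement n D → Sub n (suc k) (insert b D)
Sub-insert {n} {D = D} {b} s b∈ = record
  { sorted = Sorted-insert D (sorted s) b∉D
  ; length≡ = trans (length-insert b D) (cong suc (length≡ s))
  ; bounded = λ z∈ → [ (λ { refl → b∈[1,n] }) , bounded s ]′ (∈-insert⁻ b D z∈)
  }
  where
  b∈[1,n] = proj₁ (∈-complement⁻ n D b∈)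
  b∉D = proj₂ (∈-complement⁻ n D b∈)

Sub-hole-removed : ∀ {n k} xs {a ys} → Sub n (suc k) (xs ++ a ∷ ys) → Sub n k (xs ++ ys)
Sub-hole-removed xs s = record
  { sorted = Sorted-hole-removed xs (sorted s)
  ; length≡ = suc-injective (trans (sym (length-hole xs)) (length≡ s))
  ; bounded = bounded s ∘ ∈-hole⁺ xs
  }

Sub-hole-replaced : ∀ {n k} xs {a a' ys} → Sub n k (xs ++ a ∷ ys) → a' ∈ [ 1 , n ] →
  All (_< a') xs → All (a' <_) ys → Sub n k (xs ++ a' ∷ ys)
Sub-hole-replaced xs s a'∈ xs<a' a'<ys = record
  { sorted = Sorted-hole-replaced xs (sorted s) xs<a' a'<ys
  ; length≡ = trans (length-hole xs) (trans (sym (length-hole xs)) (length≡ s))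
  ; bounded = λ z∈ → [ (λ { refl → a'∈ }) , bounded s ∘ ∈-hole⁺ xs ]′ (∈-hole⁻ xs z∈)
  }

Sub-hole-suc : ∀ {n k} xs {a ys} → Sub n k (xs ++ a ∷ ys) → suc a ≤ n → All (suc a <_) ys →
  Sub n k (xs ++ suc a ∷ ys)
Sub-hole-suc xs s 1+a≤n 1+a<ys = Sub-hole-replaced xs s (∈-interval⁺ (s≤s z≤n) 1+a≤n)
  (All.map m<n⇒m<1+n (hole-above xs (sorted s))) 1+a<ys

Sub-hole-pred : ∀ {n k} xs {a ys} → Sub n k (xs ++ suc a ∷ ys) → 1 ≤ a → All (_< a) xs →
  Sub n k (xs ++ a ∷ ys)
Sub-hole-pred xs s 1≤a xs<a =
  Sub-hole-replaced xs s (∈-interval⁺ 1≤a (<⇒≤ (proj₂ (∈-interval⁻ (bounded s (∈-hole xs))))))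
    xs<a (All.map (<-trans (n<1+n _)) (hole-below xs (sorted s)))

hole∈complement : ∀ {n k} xs {a ys} → Sub n k (xs ++ a ∷ ys) → a ∈ complement n (xs ++ ys)
hole∈complement {n} xs {a} {ys} s =
  ∈-complement⁺ n (xs ++ ys) (bounded s (∈-hole xs)) (hole-∉ xs (sorted s))

-- Sign sequences with at most one sign change

_≟ₛ_ : DecidableEquality Sign
⊕ ≟ₛ ⊕ = yes refl
⊕ ≟ₛ ⊖ = no λ ()
⊖ ≟ₛ ⊕ = no λ ()
⊖ ≟ₛ ⊖ = yes refl

≢⊕⇒≡⊖ : ∀ {s} → s ≢ ⊕ → s ≡ ⊖
≢⊕⇒≡⊖ {⊕} s≢⊕ = contradiction refl s≢⊕
≢⊕⇒≡⊖ {⊖} _ = refl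

differ≡0⇒≡ : ∀ {s t} → differ s t ≡ 0 → s ≡ t
differ≡0⇒≡ {⊕} {⊕} _ = refl
differ≡0⇒≡ {⊖} {⊖} _ = refl

≢⇒differ≡1 : ∀ {s t} → s ≢ t → differ s t ≡ 1
≢⇒differ≡1 {⊕} {⊕} s≢t = contradiction refl s≢t
≢⇒differ≡1 {⊕} {⊖} _ = refl
≢⇒differ≡1 {⊖} {⊕} _ = refl
≢⇒differ≡1 {⊖} {⊖} s≢t = contradiction refl s≢t

LeftAlignedSigns : List Sign → Set
LeftAlignedSigns s = head s ≡ just ⊕ × last s ≡ just ⊖

leftAligned? : ∀ s → Dec (LeftAlignedSigns s)
leftAligned? s = Maybeₚ.≡-dec _≟ₛ_ (head s) (just ⊕) ×-dec Maybeₚ.≡-dec _≟ₛ_ (last s) (just ⊖)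

last-∷ : ∀ {A : Set} (w : A) rest → Σ A λ z → last (w ∷ rest) ≡ just z
last-∷ w [] = w , refl
last-∷ _ (r ∷ rs) = last-∷ r rs

last-∈ : ∀ {A : Set} {xs} {z : A} → last xs ≡ just z → z ∈ xs
last-∈ {xs = _ ∷ []} refl = here refl
last-∈ {xs = _ ∷ _ ∷ _} eq = there (last-∈ eq)

Sorted-last-max : ∀ {xs z y} → Sorted xs → last xs ≡ just z → y ∈ xs → y ≤ z
Sorted-last-max {_ ∷ []} _ refl (here refl) = ≤-refl
Sorted-last-max {_ ∷ _ ∷ _} (x< ∷ _) eq (here refl) = <⇒≤ (All.lookup x< (last-∈ eq))
Sorted-last-max {_ ∷ _ ∷ _} (_ ∷ s) eq (there y∈) = Sorted-last-max s eq y∈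

module _ (g : ℕ → Sign) where

  no-change⇒constant : ∀ {w rest y} → signChanges (map g (w ∷ rest)) ≡ 0 → y ∈ w ∷ rest →
    g y ≡ g w
  no-change⇒constant _ (here refl) = refl
  no-change⇒constant {w} {r ∷ _} none (there y∈) =
    trans (no-change⇒constant (m+n≡0⇒n≡0 (differ (g w) (g r)) none) y∈)
          (sym (differ≡0⇒≡ (m+n≡0⇒m≡0 _ none)))

  same-sign-before : ∀ {w rest z y} → Sorted (w ∷ rest) → signChanges (map g (w ∷ rest)) ≤ 1 →
    z ∈ w ∷ rest → g z ≡ g w → y ∈ w ∷ rest → y ≤ z → g y ≡ g w
  same-sign-before _ _ _ _ (here refl) _ = refl
  same-sign-before {w} {r ∷ rs} (w< ∷ s) ≤1 z∈ gz≡gw (there y∈) y≤z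
    with ∈-tail z∈ (<-≤-trans (All.lookup w< y∈) y≤z) | g w ≟ₛ g r
  ... | z∈r∷rs | yes gw≡gr = trans
    (same-sign-before s (≤-trans (m≤n+m _ _) ≤1) z∈r∷rs (trans gz≡gw gw≡gr) y∈ y≤z) (sym gw≡gr)
  ... | z∈r∷rs | no gw≢gr =
    contradiction (trans (sym gz≡gw) (no-change⇒constant rest-constant z∈r∷rs)) gw≢gr
    where
    rest-constant : signChanges (map g (r ∷ rs)) ≡ 0
    rest-constant = n≤0⇒n≡0 (s≤s⁻¹ (subst (λ c → c + _ ≤ 1) (≢⇒differ≡1 gw≢gr) ≤1))

  plus-before-plus : ∀ {xs x y} → Sorted xs → signChanges (map g xs) ≤ 1 →
    head (map g xs) ≡ just ⊕ → x ∈ xs → g x ≡ ⊕ → y ∈ xs → y ≤ x → g y ≡ ⊕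
  plus-before-plus {_ ∷ _} s ≤1 head⊕ x∈ gx y∈ y≤x =
    trans (same-sign-before s ≤1 x∈ (trans gx (sym gw)) y∈ y≤x) gw
    where gw = Maybeₚ.just-injective head⊕

  plus-after-plus : ∀ {xs x y} → Sorted xs → signChanges (map g xs) ≤ 1 →
    ¬ LeftAlignedSigns (map g xs) → x ∈ xs → g x ≡ ⊕ → y ∈ xs → x ≤ y → g y ≡ ⊕
  plus-after-plus {w ∷ rest} {x} {y} s ≤1 ¬aligned x∈ gx y∈ x≤y with g w ≟ₛ ⊕ | last-∷ w rest
  ... | yes gw | z , last≡z =
    trans (same-sign-before s ≤1 (last-∈ last≡z) (trans gz (sym gw)) y∈ (Sorted-last-max s last≡z y∈))
          gw
    where
    gz : g z ≡ ⊕
    gz with g z ≟ₛ ⊕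
    ... | yes gz = gz
    ... | no gz≢⊕ = contradiction (cong just gw , last⊖) ¬aligned
      where
      last⊖ = trans (last-map g (w ∷ rest))
                    (trans (cong (Maybe.map g) last≡z) (cong just (≢⊕⇒≡⊖ gz≢⊕)))
  ... | no gw≢⊕ | _ with g y ≟ₛ ⊕
  ...   | yes gy = gy
  ...   | no gy≢⊕ =
    contradiction (trans (sym gx) (trans (same-sign-before s ≤1 y∈ gy≡gw x∈ x≤y) gw)) λ ()
    where
    gw = ≢⊕⇒≡⊖ gw≢⊕
    gy≡gw = trans (≢⊕⇒≡⊖ gy≢⊕) (sym gw)

-- 1-based like removeAt; the index 0 and indices beyond the length give junk values.
nth : ℕ → List ℕ → ℕ
nth _ [] = 0
nth zero (x ∷ _) = x
nth (suc zero) (x ∷ _) = x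
nth (suc (suc j)) (_ ∷ xs) = nth (suc j) xs

removeAt-hole : ∀ xs {a : ℕ} {ys} → removeAt (suc (length xs)) (xs ++ a ∷ ys) ≡ xs ++ ys
removeAt-hole [] = refl
removeAt-hole (x ∷ xs) = cong (x ∷_) (removeAt-hole xs)

removeAt-split : ∀ {j} C → 1 ≤ j → j ≤ length C →
  ∃₂ λ us vs → C ≡ us ++ nth j C ∷ vs × suc (length us) ≡ j × removeAt j C ≡ us ++ vs
removeAt-split {suc zero} (x ∷ xs) _ _ = [] , xs , refl , refl , refl
removeAt-split {suc (suc j)} (x ∷ xs) _ (s≤s j<) with removeAt-split xs (s≤s z≤n) j<
... | us , vs , split , len , eq = x ∷ us , vs , cong (x ∷_) split , cong suc len , cong (x ∷_) eq

removeAt-elsewhere : ∀ {j} xs {a a' ys} → 1 ≤ j → j ≢ suc (length xs) →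
  ∃₂ λ us vs → removeAt j (xs ++ a ∷ ys) ≡ us ++ a ∷ vs × removeAt j (xs ++ a' ∷ ys) ≡ us ++ a' ∷ vs
             × nth j (xs ++ a ∷ ys) ≡ nth j (xs ++ a' ∷ ys)
removeAt-elsewhere {suc zero} [] _ j≢ = contradiction refl j≢
removeAt-elsewhere {suc (suc j)} [] {ys = ys} _ _ = [] , removeAt (suc j) ys , refl , refl , refl
removeAt-elsewhere {suc zero} (x ∷ xs) {ys = ys} _ _ = xs , ys , refl , refl , refl
removeAt-elsewhere {suc (suc j)} (x ∷ xs) _ j≢ with removeAt-elsewhere xs (s≤s z≤n) (j≢ ∘ cong suc)
... | us , vs , eq , eq' , nth≡ = x ∷ us , vs , cong (x ∷_) eq , cong (x ∷_) eq' , nth≡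

nth-∈ : ∀ {j} C → 1 ≤ j → j ≤ length C → nth j C ∈ C
nth-∈ {suc zero} (x ∷ _) _ _ = here refl
nth-∈ {suc (suc j)} (_ ∷ xs) _ (s≤s j<) = there (nth-∈ xs (s≤s z≤n) j<)

Sorted-nth-< : ∀ {j j'} C → Sorted C → 1 ≤ j → j < j' → j' ≤ length C → nth j C < nth j' C
Sorted-nth-< {suc zero} {suc (suc j')} (_ ∷ xs) (x< ∷ _) _ _ (s≤s j'<) =
  All.lookup x< (nth-∈ xs (s≤s z≤n) j'<)
Sorted-nth-< {suc (suc j)} {suc (suc j')} (_ ∷ xs) (_ ∷ s) _ (s≤s j<j') (s≤s j'<) =
  Sorted-nth-< xs s (s≤s z≤n) j<j' j'<
Sorted-nth-< {suc zero} {suc zero} _ _ _ (s≤s ()) _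

Neighbours : ℕ → ℕ → Set
Neighbours a a' = a' ≡ suc a ⊎ a ≡ suc a'

Neighbours-sym : ∀ {a a'} → Neighbours a a' → Neighbours a' a
Neighbours-sym = Sum.swap

Neighbours⇒≢ : ∀ {a a'} → Neighbours a a' → a ≢ a'
Neighbours⇒≢ (inj₁ refl) = 1+n≢n ∘ sym
Neighbours⇒≢ (inj₂ refl) = 1+n≢n

Neighbours⇒≤1+ : ∀ {a a'} → Neighbours a a' → a ≤ suc a'
Neighbours⇒≤1+ (inj₁ refl) = m≤n⇒m≤1+n (n≤1+n _)
Neighbours⇒≤1+ (inj₂ refl) = ≤-refl

next-∈ : ∀ {a rest} → All (a <_) rest → Sorted rest → suc a ∈ rest → ∃ λ vs → rest ≡ suc a ∷ vs
next-∈ _ _ (here refl) = _ , refl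
next-∈ (a<r ∷ _) (r< ∷ _) (there 1+a∈) = contradiction (s≤s⁻¹ (All.lookup r< 1+a∈)) (<⇒≱ a<r)

Sorted-consecutive : ∀ {L a} → Sorted L → a ∈ L → suc a ∈ L → Consecutive a (suc a) L
Sorted-consecutive {a = a} s a∈ 1+a∈ with ∈-∃++ a∈
... | us , rest , refl with Sorted-++⁻ us s | ∈-++⁻ us 1+a∈
...   | _ , _ , us< | inj₁ 1+a∈us =
  contradiction (All.head (All.lookup us< 1+a∈us)) (<-asym (n<1+n a))
...   | _ | inj₂ (here 1+a≡a) = contradiction 1+a≡a 1+n≢n
...   | _ , a< ∷ s-rest , _ | inj₂ (there 1+a∈rest) with next-∈ a< s-rest 1+a∈rest
...     | vs , refl = us , vs , refl

Consecutive-map : ∀ {A B : Set} (f : A → B) {a a' L} →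
  Consecutive a a' L → Consecutive (f a) (f a') (map f L)
Consecutive-map f {a} {a'} (us , vs , refl) = map f us , map f vs , map-++ f us (a ∷ a' ∷ vs)

-- Series of a co-signotope

-- d = suc k, the case d = 0 being trivial.
module Connectivity {n k p : ℕ} (d≤n : suc k ≤ n) (p≤n∸d : p ≤ n ∸ suc k) (τ : List ℕ → Sign)
  (cosignotope : IsCoSignotope n (suc k) τ) (plus-count : HasPlusCount n (suc k) p τ) where

  d : ℕ
  d = suc k

  -- row (removeAt j B) is the (τ,B,j)-series, so LeftAligned n τ B j unfolds to
  -- Aligned (removeAt j B).
  entry : List ℕ → ℕ → Sign
  entry D y = τ (insert y D)

  row : List ℕ → List Sign
  row D = map (entry D) (complement n D)

  Aligned : List ℕ → Set
  Aligned D = LeftAlignedSigns (row D)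

  PlusUpTo : List ℕ → ℕ → Set
  PlusUpTo D α = ∀ {y} → y ∈ complement n D → y ≤ α → entry D y ≡ ⊕

  PlusFrom : List ℕ → ℕ → Set
  PlusFrom D β = ∀ {y} → y ∈ complement n D → β ≤ y → entry D y ≡ ⊕

  record PlusEntry (D : List ℕ) (b : ℕ) : Set where
    field
      facet   : Sub n k D
      ∈row    : b ∈ complement n D
      entry≡⊕ : entry D b ≡ ⊕

  open PlusEntry

  plus-subsets≤p : ∀ {Rs} → Unique Rs → (∀ {R} → R ∈ Rs → IsSubset n d R × τ R ≡ ⊕) →
    length Rs ≤ p
  plus-subsets≤p {Rs} unique plus =
    let (_ , _ , |L|≡p , L-spec) = plus-count in
    subst (length Rs ≤_) |L|≡p (Unique-⊆⇒length≤ unique (λ R∈ → proj₂ (L-spec _) (plus R∈)))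

  row-changes≤1 : ∀ {D b} → Sub n k D → b ∈ complement n D → signChanges (row D) ≤ 1
  row-changes≤1 {D} {b} sD b∈ with insert-split b D
  ... | us , vs , refl , inserted =
    subst (λ D → signChanges (row D) ≤ 1) (removeAt-hole us)
      (cosignotope (us ++ b ∷ vs) (Sub⇒IsSubset (subst (Sub n d) inserted (Sub-insert sD b∈)))
                   (suc (length us)) (s≤s z≤n) p≤d)
    where
    |C|≡d : length (us ++ b ∷ vs) ≡ d
    |C|≡d = trans (length-hole us) (cong suc (length≡ sD))
    p≤d : suc (length us) ≤ d
    p≤d = subst (suc (length us) ≤_) |C|≡d (hole-position≤ us)

  plus-up-to : ∀ {D b} → PlusEntry D b → Aligned D → PlusUpTo D b
  plus-up-to {D} e aligned = plus-before-plus (entry D) (Sorted-complement n D)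
    (row-changes≤1 (facet e) (∈row e)) (proj₁ aligned) (∈row e) (entry≡⊕ e)

  plus-from : ∀ {D b} → PlusEntry D b → ¬ Aligned D → PlusFrom D b
  plus-from {D} e ¬aligned = plus-after-plus (entry D) (Sorted-complement n D)
    (row-changes≤1 (facet e) (∈row e)) ¬aligned (∈row e) (entry≡⊕ e)

  p<length-row : ∀ {D} → Sub n k D → p < length (complement n D)
  p<length-row {D} sD = begin-strict
    p                         ≤⟨ p≤n∸d ⟩
    n ∸ suc k                 <⟨ ∸-monoʳ-< (n<1+n k) d≤n ⟩
    n ∸ k                     ≡⟨ cong (n ∸_) (length≡ sD) ⟨
    n ∸ length D              ≤⟨ m≤n+o⇒m∸n≤o n (length D) (length-complement n D) ⟩
    length (complement n D)   ∎
    where open ≤-Reasoning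

  -- For each y ∉ Du take Du ∪ {y} if y ≤ α and Dv ∪ {y} otherwise: n - d + 1 distinct +-subsets.
  ¬overlapping-plus-runs : ∀ {Du Dv α β} → Sub n k Du → Sub n k Dv → β ≤ α →
    (∀ {z} → α < z → z ∈ Dv → z ∈ Du) → PlusUpTo Du α → PlusFrom Dv β → ⊥
  ¬overlapping-plus-runs {Du} {Dv} {α} {β} sDu sDv β≤α Dv⊆Du up-to from =
    <⇒≱ (subst (p <_) (sym (length-map glued (complement n Du))) (p<length-row sDu))
      (plus-subsets≤p (Unique-map-sorted glued (Sorted-complement n Du) glued-injective) glued-plus)
    where
    side : ℕ → List ℕ
    side y with y ≤? α
    ... | yes _ = Du
    ... | no _ = Dv

    side-entry : ∀ {y} → y ∈ complement n Du → PlusEntry (side y) y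
    side-entry {y} y∈ with y ≤? α
    ... | yes y≤α = record { facet = sDu ; ∈row = y∈ ; entry≡⊕ = up-to y∈ y≤α }
    ... | no y≰α = record
      { facet = sDv ; ∈row = y∈row ; entry≡⊕ = from y∈row (≤-trans β≤α (<⇒≤ (≰⇒> y≰α))) }
      where
      y∈row = ∈-complement⁺ n Dv (proj₁ (∈-complement⁻ n Du y∈))
                (proj₂ (∈-complement⁻ n Du y∈) ∘ Dv⊆Du (≰⇒> y≰α))

    later∉side : ∀ {y y'} → y' ∈ complement n Du → y < y' → y' ∉ side y
    later∉side {y} y'∈ y<y' with y ≤? α
    ... | yes _ = proj₂ (∈-complement⁻ n Du y'∈)
    ... | no y≰α = proj₂ (∈-complement⁻ n Du y'∈) ∘ Dv⊆Du (<-trans (≰⇒> y≰α) y<y')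

    glued : ℕ → List ℕ
    glued y = insert y (side y)

    glued-injective : ∀ {y y'} → y ∈ complement n Du → y' ∈ complement n Du → y < y' →
      glued y ≢ glued y'
    glued-injective {y} {y'} _ y'∈ y<y' same = later∉side y'∈ y<y'
      (∈-insert-≢ (subst (y' ∈_) (sym same) (∈-insert⁺ˡ y' (side y'))) (>⇒≢ y<y'))

    glued-plus : ∀ {R} → R ∈ map glued (complement n Du) → IsSubset n d R × τ R ≡ ⊕
    glued-plus R∈ with ∈-map⁻ glued R∈
    ... | y , y∈ , refl = Sub⇒IsSubset (Sub-insert (facet e) (∈row e)) , entry≡⊕ e
      where e = side-entry y∈

  aligned-downward : ∀ {D D' b b'} → PlusEntry D b → PlusEntry D' b' →
    insert b D ≡ insert b' D' → b < b' → Aligned D' → Aligned D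
  aligned-downward {D} {D'} {b} {b'} e e' same b<b' aligned' with leftAligned? (row D)
  ... | yes aligned = aligned
  ... | no ¬aligned = ⊥-elim (¬overlapping-plus-runs (facet e') (facet e) (<⇒≤ b<b') D⊆D'
                                (plus-up-to e' aligned') (plus-from e ¬aligned))
    where
    D⊆D' : ∀ {z} → b' < z → z ∈ D → z ∈ D'
    D⊆D' b'<z z∈D = ∈-insert-≢ (subst (_ ∈_) same (∈-insert⁺ʳ b z∈D)) (>⇒≢ b'<z)

  aligned-transfer : ∀ xs {a a' ys b} → Neighbours a a' →
    PlusEntry (xs ++ a ∷ ys) b → PlusEntry (xs ++ a' ∷ ys) b →
    Aligned (xs ++ a ∷ ys) → Aligned (xs ++ a' ∷ ys)
  aligned-transfer xs {a} {a'} {ys} {b} a~a' e e' aligned with leftAligned? (row (xs ++ a' ∷ ys))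
  ... | yes aligned' = aligned'
  ... | no ¬aligned' = ⊥-elim clash
    where
    D = xs ++ a ∷ ys
    D' = xs ++ a' ∷ ys
    swap : insert a' D ≡ insert a D'
    swap = insert-swap xs (sorted (facet e)) (sorted (facet e')) (Neighbours⇒≢ a~a')
    a'∈row : a' ∈ complement n D
    a'∈row = ∈-complement⁺ n D (bounded (facet e') (∈-hole xs))
               (hole-∉-swap xs (sorted (facet e')) (Neighbours⇒≢ a~a' ∘ sym))
    a∈row' : a ∈ complement n D'
    a∈row' = ∈-complement⁺ n D' (bounded (facet e) (∈-hole xs))
               (hole-∉-swap xs (sorted (facet e)) (Neighbours⇒≢ a~a'))
    D'⊆D : ∀ {z} → a' < z → z ∈ D' → z ∈ D
    D'⊆D a'<z z∈D' = [ (λ z≡a' → contradiction z≡a' (>⇒≢ a'<z)) , ∈-hole⁺ xs ]′ (∈-hole⁻ xs z∈D')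
    clash : ⊥
    clash with <-cmp a' b
    ... | tri< a'<b _ _ = ¬overlapping-plus-runs (facet e) (facet e') a≤b (D'⊆D ∘ <-trans a'<b)
                            (plus-up-to e aligned) (plus-from e-a ¬aligned')
      where
      a≤b = ≤-trans (Neighbours⇒≤1+ a~a') a'<b
      e-a : PlusEntry D' a
      e-a = record { facet = facet e' ; ∈row = a∈row'
                   ; entry≡⊕ = trans (cong τ (sym swap)) (plus-up-to e aligned a'∈row (<⇒≤ a'<b)) }
    ... | tri≈ _ refl _ = proj₂ (∈-complement⁻ n D' (∈row e')) (∈-hole xs)
    ... | tri> _ _ b<a' = ¬overlapping-plus-runs (facet e) (facet e') (<⇒≤ b<a') D'⊆D
                            (plus-up-to e-a' aligned) (plus-from e' ¬aligned')
      where
      b≤a = s≤s⁻¹ (<-≤-trans b<a' (Neighbours⇒≤1+ (Neighbours-sym a~a')))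
      e-a' : PlusEntry D a'
      e-a' = record { facet = facet e ; ∈row = a'∈row
                    ; entry≡⊕ = trans (cong τ swap) (plus-from e' ¬aligned' a∈row' b≤a) }

  hole-entry : ∀ xs {a ys} → Sub n d (xs ++ a ∷ ys) → τ (xs ++ a ∷ ys) ≡ ⊕ →
    PlusEntry (xs ++ ys) a
  hole-entry xs s τ≡⊕ = record
    { facet = Sub-hole-removed xs s
    ; ∈row = hole∈complement xs s
    ; entry≡⊕ = trans (cong τ (insert-hole xs (sorted s))) τ≡⊕
    }

  row-entry : ∀ {C j} → Sub n d C → τ C ≡ ⊕ → 1 ≤ j → j ≤ d →
    PlusEntry (removeAt j C) (nth j C) × insert (nth j C) (removeAt j C) ≡ C
  row-entry {C} {j} s τ≡⊕ 1≤j j≤d with removeAt-split C 1≤j (subst (j ≤_) (sym (length≡ s)) j≤d)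
  ... | us , vs , split , _ , removed =
    subst (λ D → PlusEntry D b) (sym removed) (hole-entry us s' (subst (λ X → τ X ≡ ⊕) split τ≡⊕)) ,
    trans (cong (insert b) removed) (trans (insert-hole us (sorted s')) (sym split))
    where
    b = nth j C
    s' = subst (Sub n d) split s

  aligned-prefix : ∀ {C j j'} → Sub n d C → τ C ≡ ⊕ → 1 ≤ j → j < j' → j' ≤ d →
    LeftAligned n τ C j' → LeftAligned n τ C j
  aligned-prefix {C} s τ≡⊕ 1≤j j<j' j'≤d
    with row-entry s τ≡⊕ 1≤j (<⇒≤ (<-≤-trans j<j' j'≤d))
       | row-entry s τ≡⊕ (≤-trans 1≤j (<⇒≤ j<j')) j'≤d
  ... | e , inserted | e' , inserted' =
    aligned-downward e e' (trans inserted (sym inserted'))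
      (Sorted-nth-< C (sorted s) 1≤j j<j' (subst (_ ≤_) (sym (length≡ s)) j'≤d))

  aligned-elsewhere : ∀ xs {a a' ys j} → Neighbours a a' →
    Sub n d (xs ++ a ∷ ys) → τ (xs ++ a ∷ ys) ≡ ⊕ →
    Sub n d (xs ++ a' ∷ ys) → τ (xs ++ a' ∷ ys) ≡ ⊕ →
    1 ≤ j → j ≤ d → j ≢ suc (length xs) →
    LeftAligned n τ (xs ++ a ∷ ys) j → LeftAligned n τ (xs ++ a' ∷ ys) j
  aligned-elsewhere xs {a} {a'} {ys} {j} a~a' s τ≡⊕ s' τ≡⊕' 1≤j j≤d j≢
    with removeAt-elsewhere {j} xs {a} {a'} {ys} 1≤j j≢
  ... | us , vs , removed , removed' , same-nth =
    subst Aligned (sym removed') ∘ aligned-transfer us a~a' e e' ∘ subst Aligned removed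
    where
    e = subst₂ PlusEntry removed refl (proj₁ (row-entry s τ≡⊕ 1≤j j≤d))
    e' = subst₂ PlusEntry removed' (sym same-nth) (proj₁ (row-entry s' τ≡⊕' 1≤j j≤d))

  record AlignedUpTo (i : ℕ) (C : List ℕ) : Set where
    field
      subset  : Sub n d C
      τ≡⊕     : τ C ≡ ⊕
      aligned : ∀ {j} → 1 ≤ j → j ≤ d → LeftAligned n τ C j ⇔ j ≤ i

  open AlignedUpTo

  move : ∀ {i} xs {a a' ys} → Neighbours a a' → AlignedUpTo i (xs ++ a ∷ ys) →
    Sub n d (xs ++ a' ∷ ys) → (a ≤ a' × i < suc (length xs)) ⊎ (a' ≤ a × suc (length xs) ≤ i) →
    AlignedUpTo i (xs ++ a' ∷ ys)
  move {i} xs {a} {a'} {ys} a~a' g s' direction = record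
    { subset = s'
    ; τ≡⊕ = τ≡⊕'
    ; aligned = λ 1≤j j≤d → aligned g 1≤j j≤d ⇔-∘ same-alignment 1≤j j≤d
    }
    where
    p≤d : suc (length xs) ≤ d
    p≤d = subst (_ ≤_) (length≡ (subset g)) (hole-position≤ xs)
    hole-aligned : Aligned (xs ++ ys) ⇔ suc (length xs) ≤ i
    hole-aligned = subst (λ D → Aligned D ⇔ _) (removeAt-hole xs) (aligned g (s≤s z≤n) p≤d)
    e = hole-entry xs (subset g) (τ≡⊕ g)
    a'∈row = hole∈complement xs s'
    moved-entry : entry (xs ++ ys) a' ≡ ⊕
    moved-entry =
      [ (λ (a≤a' , i<p) → plus-from e (<⇒≱ i<p ∘ Equivalence.to hole-aligned) a'∈row a≤a')
      , (λ (a'≤a , p≤i) → plus-up-to e (Equivalence.from hole-aligned p≤i) a'∈row a'≤a)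
      ]′ direction
    τ≡⊕' : τ (xs ++ a' ∷ ys) ≡ ⊕
    τ≡⊕' = trans (cong τ (sym (insert-hole xs (sorted s')))) moved-entry
    same-alignment : ∀ {j} → 1 ≤ j → j ≤ d →
      LeftAligned n τ (xs ++ a' ∷ ys) j ⇔ LeftAligned n τ (xs ++ a ∷ ys) j
    same-alignment {j} 1≤j j≤d with j ≟ suc (length xs)
    ... | yes refl = mk⇔ (subst Aligned same-row) (subst Aligned (sym same-row))
      where same-row = trans (removeAt-hole xs) (sym (removeAt-hole xs))
    ... | no j≢p = mk⇔
      (aligned-elsewhere xs (Neighbours-sym a~a') s' τ≡⊕' (subset g) (τ≡⊕ g) 1≤j j≤d j≢p)
      (aligned-elsewhere xs a~a' (subset g) (τ≡⊕ g) s' τ≡⊕' 1≤j j≤d j≢p)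

  hole-adjacent-suc : ∀ xs {a ys} → Sub n d (xs ++ a ∷ ys) → Sub n d (xs ++ suc a ∷ ys) →
    Adjacent n d (xs ++ a ∷ ys) (xs ++ suc a ∷ ys)
  hole-adjacent-suc xs {a} {ys} s s' =
    xs ++ a ∷ ys , suc (length xs) , Sub⇒IsSubset s , s≤s z≤n ,
    subst (_ ≤_) (length≡ s) (hole-position≤ xs) ,
    inj₁ (subst (λ D → Consecutive C C' (map (λ x → insert x D) (complement n D)))
                (sym (removeAt-hole xs)) in-series)
    where
    C = xs ++ a ∷ ys
    C' = xs ++ suc a ∷ ys
    D = xs ++ ys
    series′ = map (λ x → insert x D) (complement n D)
    in-series : Consecutive C C' series′
    in-series = subst₂ (λ C C' → Consecutive C C' series′)
      (insert-hole xs (sorted s)) (insert-hole xs (sorted s'))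
      (Consecutive-map (λ x → insert x D)
        (Sorted-consecutive (Sorted-complement n D) (hole∈complement xs s) (hole∈complement xs s')))

  Adjacent-sym : ∀ {A A'} → Adjacent n d A A' → Adjacent n d A' A
  Adjacent-sym (B , j , isB , 1≤j , j≤d , consecutive) =
    B , j , isB , 1≤j , j≤d , Sum.swap consecutive

  hole-adjacent : ∀ xs {a a' ys} → Neighbours a a' →
    Sub n d (xs ++ a ∷ ys) → Sub n d (xs ++ a' ∷ ys) → Adjacent n d (xs ++ a' ∷ ys) (xs ++ a ∷ ys)
  hole-adjacent xs (inj₁ refl) s s' = Adjacent-sym (hole-adjacent-suc xs s s')
  hole-adjacent xs (inj₂ refl) s s' = hole-adjacent-suc xs s' s

  module Paths (i : ℕ) where

    Reaches : List ℕ → Set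
    Reaches C = AlignedUpTo i C → PlusConnected n d τ (S n d i) C

    ReducesTo : List ℕ → List ℕ → Set
    ReducesTo C C' =
      AlignedUpTo i C' × (PlusConnected n d τ (S n d i) C' → PlusConnected n d τ (S n d i) C)

    step-back : ∀ xs {a a' ys} → Neighbours a a' → AlignedUpTo i (xs ++ a ∷ ys) →
      AlignedUpTo i (xs ++ a' ∷ ys) → ReducesTo (xs ++ a ∷ ys) (xs ++ a' ∷ ys)
    step-back xs a~a' g g' =
      g' , λ reached → step reached (hole-adjacent xs a~a' (subset g) (subset g')) (τ≡⊕ g)

    slide-right : ∀ xs {q m ys} → q ≤′ m → i ≤ length xs → m ≤ n → All (m <_) ys →
      AlignedUpTo i (xs ++ q ∷ ys) → ReducesTo (xs ++ q ∷ ys) (xs ++ m ∷ ys)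
    slide-right xs ≤′-refl _ _ _ g = g , id
    slide-right xs {m = suc m} (≤′-step q≤′m) i≤|xs| 1+m≤n 1+m<ys g =
      let m<ys = All.map (<-trans (n<1+n m)) 1+m<ys
          (gm , back) = slide-right xs q≤′m i≤|xs| (<⇒≤ 1+m≤n) m<ys g
          s' = Sub-hole-suc xs (subset gm) 1+m≤n 1+m<ys
          g' = move xs (inj₁ refl) gm s' (inj₁ (n≤1+n m , s≤s i≤|xs|))
          (_ , back') = step-back xs (inj₁ refl) gm g'
      in g' , back ∘ back'

    slide-left : ∀ xs {m q ys} → m ≤′ q → suc (length xs) ≤ i → 1 ≤ m → All (_< m) xs →
      AlignedUpTo i (xs ++ q ∷ ys) → ReducesTo (xs ++ q ∷ ys) (xs ++ m ∷ ys)
    slide-left xs ≤′-refl _ _ _ g = g , id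
    slide-left xs {q = suc q} (≤′-step m≤′q) p≤i 1≤m xs<m g =
      let m≤q = ≤′⇒≤ m≤′q
          xs<q = All.map (λ x<m → <-≤-trans x<m m≤q) xs<m
          s' = Sub-hole-pred xs (subset g) (≤-trans 1≤m m≤q) xs<q
          g' = move xs (inj₂ refl) g s' (inj₂ (n≤1+n q , p≤i))
          (_ , back') = step-back xs (inj₂ refl) g g'
          (gm , back) = slide-left xs m≤′q p≤i 1≤m xs<m g'
      in gm , back' ∘ back

    phase-left : ∀ a P → a + length P ≡ i → Reaches ([ 1 , a ] ++ P ++ [ suc (n ∸ d + i) , n ])
    phase-left a [] a+0≡i g with trans (sym (+-identityʳ a)) a+0≡i
    ... | refl = here (Sub⇒IsSubset (subset g)) (τ≡⊕ g)
    phase-left a (b ∷ P) a+|b∷P|≡i g =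
      let (g' , back) = slide-left [ 1 , a ] (≤⇒≤′ a<b) p≤i (s≤s z≤n) [1,a]<1+a g
      in back (subst Reaches (sym (interval-snoc a _)) (phase-left (suc a) P a+1+|P|≡i) g')
      where
      s = subset g
      a<b : a < b
      a<b = ≰⇒> λ b≤a → <-irrefl refl (All.lookup (hole-above [ 1 , a ] (sorted s))
        (∈-interval⁺ (proj₁ (∈-interval⁻ (bounded s (∈-hole [ 1 , a ])))) b≤a))
      a+1+|P|≡i : suc a + length P ≡ i
      a+1+|P|≡i = trans (sym (+-suc a _)) a+|b∷P|≡i
      p≤i : suc (length [ 1 , a ]) ≤ i
      p≤i = subst (λ x → suc x ≤ i) (sym (length-interval 1 a))
              (subst (suc a ≤_) a+1+|P|≡i (m≤m+n (suc a) _))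
      [1,a]<1+a : All (_< suc a) [ 1 , a ]
      [1,a]<1+a = All.tabulate (s≤s ∘ proj₂ ∘ ∈-interval⁻)

    module _ (P : List ℕ) (|P|≡i : length P ≡ i) where

      right-block-start : ∀ {m} → m ≤ n → AlignedUpTo i (P ++ [ suc m , n ]) → n ∸ d + i ≡ m
      right-block-start {m} m≤n g =
        subst (λ x → n ∸ x + i ≡ m) i+[n∸m]≡d
          (n∸[i+[n∸m]]+i≡m i m≤n (subst (_≤ n) (sym i+[n∸m]≡d) d≤n))
        where
        i+[n∸m]≡d : i + (n ∸ m) ≡ d
        i+[n∸m]≡d = trans (cong₂ _+_ (sym |P|≡i) (sym (length-interval (suc m) n)))
                      (trans (sym (length-++ P)) (length≡ (subset g)))

      phase-right : ∀ R m → m ≤ n → Reaches (P ++ reverse R ++ [ suc m , n ])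
      phase-right [] m m≤n g =
        subst (λ x → Reaches (P ++ [ suc x , n ])) (right-block-start m≤n g) (phase-left 0 P |P|≡i) g
      phase-right (q ∷ R) m m≤n = subst Reaches (sym (++-reverse-∷ P q R _)) reached
        where
        xs = P ++ reverse R
        reached : Reaches (xs ++ q ∷ [ suc m , n ])
        reached g =
          let m<T = All.tabulate (proj₁ ∘ ∈-interval⁻)
              (g' , back) = slide-right xs (≤⇒≤′ q≤m) i≤|xs| m≤n m<T g
          in back (subst Reaches shifted (phase-right R (m ∸ 1) (≤-trans (m∸n≤m m 1) m≤n)) g')
          where
          s = subset g
          q-bounds = ∈-interval⁻ (bounded s (∈-hole xs))
          q≤m : q ≤ m
          q≤m = ≮⇒≥ λ m<q → <-irrefl refl
            (All.lookup (hole-below xs (sorted s)) (∈-interval⁺ m<q (proj₂ q-bounds)))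
          1≤m = ≤-trans (proj₁ q-bounds) q≤m
          i≤|xs| : i ≤ length xs
          i≤|xs| = subst (i ≤_) (sym (length-++ P)) (subst (_≤ _) |P|≡i (m≤m+n _ _))
          shifted : P ++ reverse R ++ [ suc (m ∸ 1) , n ] ≡ xs ++ m ∷ [ suc m , n ]
          shifted = begin
            P ++ reverse R ++ [ suc (m ∸ 1) , n ]
              ≡⟨ cong (λ x → P ++ reverse R ++ [ x , n ]) (m+[n∸m]≡n 1≤m) ⟩
            P ++ reverse R ++ [ m , n ]
              ≡⟨ cong (λ X → P ++ reverse R ++ X) (interval-unfoldˡ m≤n) ⟩
            P ++ reverse R ++ m ∷ [ suc m , n ]
              ≡⟨ ++-assoc P (reverse R) _ ⟨
            xs ++ m ∷ [ suc m , n ]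
              ∎
            where open ≡-Reasoning

  largest⇒aligned-up-to : ∀ {B i} → IsSubset n d B → τ B ≡ ⊕ → IsLargestLeftAligned n d τ B i →
    AlignedUpTo i B
  largest⇒aligned-up-to {B} {i} isB τB largest =
    record { subset = IsSubset⇒Sub isB ; τ≡⊕ = τB ; aligned = exactly largest }
    where
    exactly : IsLargestLeftAligned n d τ B i → ∀ {j} → 1 ≤ j → j ≤ d → LeftAligned n τ B j ⇔ j ≤ i
    exactly (inj₁ (refl , none)) 1≤j j≤d = mk⇔ (⊥-elim ∘ none _ 1≤j j≤d) (⊥-elim ∘ <⇒≱ 1≤j)
    exactly (inj₂ (_ , i≤d , aligned-i , none-above)) {j} 1≤j j≤d = mk⇔ to from
      where
      to : LeftAligned n τ B j → j ≤ i
      to aligned-j = ≮⇒≥ λ i<j → none-above j i<j j≤d aligned-j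
      from : j ≤ i → LeftAligned n τ B j
      from j≤i with m≤n⇒m<n∨m≡n j≤i
      ... | inj₁ j<i = aligned-prefix (IsSubset⇒Sub isB) τB 1≤j j<i i≤d aligned-i
      ... | inj₂ refl = aligned-i

  connected : ∀ {B i} → IsSubset n d B → τ B ≡ ⊕ → IsLargestLeftAligned n d τ B i →
    PlusConnected n d τ (S n d i) B
  connected {B} {i} isB τB largest =
    subst (Paths.Reaches i) B≡
      (Paths.phase-right i (take i B) |take|≡i (reverse (drop i B)) n ≤-refl)
      (largest⇒aligned-up-to isB τB largest)
    where
    i≤d : i ≤ d
    i≤d = [ (λ (i≡0 , _) → subst (_≤ d) (sym i≡0) z≤n) , (λ (_ , i≤d , _) → i≤d) ]′ largest
    |take|≡i : length (take i B) ≡ i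
    |take|≡i = trans (length-take i B) (m≤n⇒m⊓n≡m (subst (i ≤_) (sym (proj₁ (proj₂ isB))) i≤d))
    B≡ : take i B ++ reverse (reverse (drop i B)) ++ [ suc n , n ] ≡ B
    B≡ = begin
      take i B ++ reverse (reverse (drop i B)) ++ [ suc n , n ]
        ≡⟨ cong₂ (λ X Y → take i B ++ X ++ Y) (reverse-involutive (drop i B)) (interval-empty n) ⟩
      take i B ++ drop i B ++ []
        ≡⟨ cong (take i B ++_) (++-identityʳ (drop i B)) ⟩
      take i B ++ drop i B
        ≡⟨ take++drop≡id i B ⟩
      B ∎
      where open ≡-Reasoning

S-degenerate : ∀ n → S n 0 0 ≡ []
S-degenerate n = trans (cong (λ m → [ suc m , n ]) (+-identityʳ n)) (interval-empty n)

corollary11 : (n d p : ℕ) → d < n → 1 ≤ p → p ≤ n ∸ d →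
              (τ : List ℕ → Sign) → InSbar p n d τ →
              (B : List ℕ) → IsSubset n d B → τ B ≡ ⊕ →
              (i : ℕ) → IsLargestLeftAligned n d τ B i →
              PlusConnected n d τ (S n d i) B
corollary11 n zero _ _ _ _ τ _ [] isB τB _ (inj₁ (refl , _)) =
  subst (λ A → PlusConnected n 0 τ A []) (sym (S-degenerate n)) (here isB τB)
corollary11 n zero _ _ _ _ _ _ [] _ _ _ (inj₂ (s≤s _ , () , _))
corollary11 n zero _ _ _ _ _ _ (_ ∷ _) (_ , () , _) _ _ _
corollary11 n (suc k) _ d<n _ p≤n∸d τ (cosignotope , plus-count) _ isB τB _ largest =
  Connectivity.connected (<⇒≤ d<n) p≤n∸d τ cosignotope plus-count isB τB largest
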